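{- Let $n\ge 3$, $\lambda\in\mathbb{Z}_{\ge0}^n$, and let $(x_1,\dots,x_n)$ be a positive integer solution of \[ \sum_{i=1}^n X_i^2+\sum_{i=1}^n \lambda_i\, X_1\cdots\widehat{X_i}\cdots X_n=\Big(n+\sum_{i=1}^n\lambda_i\Big)\prod_{i=1}^n X_i . \] Fix $1\le m\le n$ and set \[ x_m'=\frac{\big(x_1^2+\cdots+x_{m-1}^2+x_{m+1}^2+\cdots+x_n^2\big)+\lambda_m\,x_1\cdots\widehat{x_m}\cdots x_n}{x_m}. \] Then $(x_1,\dots,x_{m-1},x_m',x_{m+1},\dots,x_n)$ is also a positive integer solution of this equation.
   Context: $\widehat{X_i}$ (resp. $\widehat{x_m}$) means that factor is omitted from the product. -}

module Defs where

open import Data.Nat using (ℕ; zero; suc; _+_; _*_)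
open import Data.Fin using (Fin; zero; suc; _≟_)
open import Data.Bool using (if_then_else_)
open import Relation.Nullary.Decidable using (⌊_⌋)
open import Relation.Binary.PropositionalEquality using (_≡_)

Σ : ∀ {n} → (Fin n → ℕ) → ℕ
Σ {zero}  f = 0
Σ {suc n} f = f zero + Σ (λ i → f (suc i))

Π : ∀ {n} → (Fin n → ℕ) → ℕ
Π {zero}  f = 1
Π {suc n} f = f zero * Π (λ i → f (suc i))

update : ∀ {n} → (Fin n → ℕ) → Fin n → ℕ → (Fin n → ℕ)
update x i v j = if ⌊ j ≟ i ⌋ then v else x j

prodExcept : ∀ {n} → (Fin n → ℕ) → Fin n → ℕ
prodExcept x i = Π (update x i 1)

sqSumExcept : ∀ {n} → (Fin n → ℕ) → Fin n → ℕ
sqSumExcept x i = Σ (λ j → update (λ k → x k * x k) i 0 j)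

IsSolution : ∀ {n} → (Fin n → ℕ) → (Fin n → ℕ) → Set
IsSolution {n} lam x =
  Σ (λ i → x i * x i) + Σ (λ i → lam i * prodExcept x i) ≡ (n + Σ lam) * Π x

Positive : ∀ {n} → (Fin n → ℕ) → Set
Positive x = ∀ i → 0 Data.Nat.< x i

{-# OPTIONS --safe #-}
-- Vieta jumping.  With every coordinate except X_m fixed, the equation is the
-- quadratic  X_m² + C + Q X_m = R X_m,  where C = Σ_{i≠m} x_i² + λ_m P,
-- R = (n + Σ λ) P with P = Π_{i≠m} x_i, and Q X_m = Σ_{i≠m} λ_i Π_{j≠i} x_j.
-- Since x_m is a root, so is x_m' = R − Q − x_m, and by Vieta x_m' x_m = C.
-- As C ≥ x_j² > 0 for any j ≠ m, the new root is a positive integer.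
module Submission where

open import Defs
open import Algebra.Bundles using (CommutativeMonoid)
open import Algebra.Core using (Op₂)
open import Algebra.Structures using (IsCommutativeMonoid)
import Algebra.Properties.CommutativeMonoid.Sum as MonoidSum
open import Data.Nat using (ℕ; zero; suc; _≤_; _<_; _+_; _*_; _∸_; z≤n; s≤s; >-nonZero)
open import Data.Nat.Properties
  using (+-assoc; +-comm; *-comm; *-zeroʳ; *-distribˡ-+; +-cancelʳ-≡;
         *-cancelˡ-≤; m≤m+n; m∸n+n≡m; <-≤-trans; <⇒≤;
         *-mono-<; +-0-isCommutativeMonoid; *-1-isCommutativeMonoid; *-commutativeSemigroup)
open import Algebra.Properties.CommutativeSemigroup *-commutativeSemigroup using (x∙yz≈y∙xz)
open import Data.Fin using (Fin; zero; suc; punchIn)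
open import Data.Fin.Properties using (_≟_; punchInᵢ≢i)
open import Data.List using ([]; _∷_)
open import Data.Nat.Tactic.RingSolver using (solve; solve-∀)
open import Data.Product using (Σ-syntax; _×_; _,_)
open import Data.Vec.Functional using (removeAt)
open import Function using (_∘_; _⇔_; mk⇔; Equivalence)
open import Level using (0ℓ)
open import Relation.Nullary using (contradiction)
open import Relation.Nullary.Decidable using (yes; no)
open import Relation.Binary.PropositionalEquality
open ≡-Reasoning

update-same : ∀ {n} (f : Fin n → ℕ) m v → update f m v m ≡ v
update-same f m v with m ≟ m
... | yes _   = refl
... | no m≢m = contradiction refl m≢m

update-other : ∀ {n} (f : Fin n → ℕ) {m j} v → j ≢ m → update f m v j ≡ f j
update-other f {m} {j} v j≢m with j ≟ m
... | yes j≡m = contradiction j≡m j≢m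
... | no _    = refl

update-id : ∀ {n} (f : Fin n → ℕ) m → update f m (f m) ≗ f
update-id f m j with j ≟ m
... | yes j≡m = cong f (sym j≡m)
... | no _    = refl

update-update : ∀ {n} (f : Fin n → ℕ) m v w → update (update f m v) m w ≗ update f m w
update-update f m v w j with j ≟ m
... | yes _ = refl
... | no _  = refl

update-comm : ∀ {n} (f : Fin n → ℕ) {i j} u v → i ≢ j →
              update (update f i u) j v ≗ update (update f j v) i u
update-comm f {i} {j} u v i≢j k with k ≟ i | k ≟ j
... | yes refl | yes refl = contradiction refl i≢j
... | yes _    | no _     = refl
... | no _     | yes _    = refl
... | no _     | no _     = refl

update-cong : ∀ {n} {f g : Fin n → ℕ} → f ≗ g → ∀ m v → update f m v ≗ update g m v
update-cong f≗g m v j with j ≟ m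
... | yes _ = refl
... | no _  = f≗g j

update-map : ∀ {n} (g : ℕ → ℕ) (f : Fin n → ℕ) m v → g ∘ update f m v ≗ update (g ∘ f) m (g v)
update-map g f m v j with j ≟ m
... | yes _ = refl
... | no _  = refl

update-pos : ∀ {n} {x : Fin n → ℕ} → Positive x → ∀ m {v} → 0 < v → Positive (update x m v)
update-pos pos m v>0 j with j ≟ m
... | yes _ = v>0
... | no _  = pos j

module BigOperator
  {_∙_ : Op₂ ℕ} {ε : ℕ} (isCM : IsCommutativeMonoid _≡_ _∙_ ε)
  (⨁ : ∀ {n} → (Fin n → ℕ) → ℕ)
  (⨁-zero : (f : Fin 0 → ℕ) → ⨁ f ≡ ε)
  (⨁-suc : ∀ {n} (f : Fin (suc n) → ℕ) → ⨁ f ≡ f zero ∙ ⨁ (f ∘ suc))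
  where

  private
    M : CommutativeMonoid 0ℓ 0ℓ
    M = record { isCommutativeMonoid = isCM }
    open IsCommutativeMonoid isCM using (identityˡ)
    open MonoidSum M using (sum; sum-remove; sum-cong-≗)

    ⨁≡sum : ∀ {n} (f : Fin n → ℕ) → ⨁ f ≡ sum f
    ⨁≡sum {zero}  f = ⨁-zero f
    ⨁≡sum {suc n} f = trans (⨁-suc f) (cong (f zero ∙_) (⨁≡sum (f ∘ suc)))

  ⨁-cong : ∀ {n} {f g : Fin n → ℕ} → f ≗ g → ⨁ f ≡ ⨁ g
  ⨁-cong {f = f} {g} f≗g = trans (⨁≡sum f) (trans (sum-cong-≗ f≗g) (sym (⨁≡sum g)))

  ⨁-split : ∀ {n} (f : Fin n → ℕ) m → ⨁ f ≡ f m ∙ ⨁ (update f m ε)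
  ⨁-split {suc n} f m = begin
    ⨁ f                        ≡⟨ ⨁≡sum f ⟩
    sum f                      ≡⟨ sum-remove {i = m} f ⟩
    f m ∙ sum (removeAt f m)   ≡⟨ cong (f m ∙_) sum-removeAt ⟨
    f m ∙ ⨁ (update f m ε)     ∎
    where
    sum-removeAt : ⨁ (update f m ε) ≡ sum (removeAt f m)
    sum-removeAt = begin
      ⨁ (update f m ε)                            ≡⟨ ⨁≡sum (update f m ε) ⟩
      sum (update f m ε)                          ≡⟨ sum-remove {i = m} (update f m ε) ⟩
      update f m ε m ∙ sum (removeAt (update f m ε) m)
        ≡⟨ cong₂ _∙_ (update-same f m ε) (sum-cong-≗ (update-other f ε ∘ punchInᵢ≢i m)) ⟩
      ε ∙ sum (removeAt f m)                      ≡⟨ identityˡ _ ⟩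
      sum (removeAt f m)                          ∎

  ⨁-update : ∀ {n} (f : Fin n → ℕ) m v → ⨁ (update f m v) ≡ v ∙ ⨁ (update f m ε)
  ⨁-update f m v = begin
    ⨁ (update f m v)                          ≡⟨ ⨁-split (update f m v) m ⟩
    update f m v m ∙ ⨁ (update (update f m v) m ε)
      ≡⟨ cong₂ _∙_ (update-same f m v) (⨁-cong (update-update f m v ε)) ⟩
    v ∙ ⨁ (update f m ε)                      ∎

open BigOperator +-0-isCommutativeMonoid Σ (λ _ → refl) (λ _ → refl)
  using () renaming (⨁-cong to Σ-cong; ⨁-split to Σ-split; ⨁-update to Σ-update)
open BigOperator *-1-isCommutativeMonoid Π (λ _ → refl) (λ _ → refl)
  using () renaming (⨁-cong to Π-cong; ⨁-update to Π-update)

*-distribˡ-Σ : ∀ {n} c (f : Fin n → ℕ) → c * Σ f ≡ Σ (λ i → c * f i)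
*-distribˡ-Σ {zero}  c f = *-zeroʳ c
*-distribˡ-Σ {suc n} c f =
  trans (*-distribˡ-+ c (f zero) _) (cong (c * f zero +_) (*-distribˡ-Σ c (f ∘ suc)))

f≤Σf : ∀ {n} (f : Fin n → ℕ) j → f j ≤ Σ f
f≤Σf f j = subst (f j ≤_) (sym (Σ-split f j)) (m≤m+n (f j) _)

module VietaJump {a C Q R : ℕ} (a>0 : 0 < a) (root : a * a + C + a * Q ≡ a * R) where

  private
    instance _ = >-nonZero a>0

    root′ : a * (a + Q) + C ≡ a * R
    root′ = begin
      a * (a + Q) + C     ≡⟨ solve (a ∷ C ∷ Q ∷ []) ⟩
      a * a + C + a * Q   ≡⟨ root ⟩
      a * R               ∎

    factorˡ : ∀ b c d → b * b + b * c + b * d ≡ b * (b + (c + d))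
    factorˡ = solve-∀

    a+Q≤R : a + Q ≤ R
    a+Q≤R = *-cancelˡ-≤ a (subst (a * (a + Q) ≤_) root′ (m≤m+n _ C))

  otherRoot : ℕ
  otherRoot = R ∸ (a + Q)

  otherRoot-sum : otherRoot + (a + Q) ≡ R
  otherRoot-sum = m∸n+n≡m a+Q≤R

  otherRoot-product : otherRoot * a ≡ C
  otherRoot-product = trans (*-comm otherRoot a) (+-cancelʳ-≡ (a * (a + Q)) _ _ (begin
    a * otherRoot + a * (a + Q)   ≡⟨ *-distribˡ-+ a otherRoot (a + Q) ⟨
    a * (otherRoot + (a + Q))     ≡⟨ cong (a *_) otherRoot-sum ⟩
    a * R                         ≡⟨ root′ ⟨
    a * (a + Q) + C               ≡⟨ +-comm (a * (a + Q)) C ⟩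
    C + a * (a + Q)               ∎))

  otherRoot-root : otherRoot * otherRoot + C + otherRoot * Q ≡ otherRoot * R
  otherRoot-root = begin
    otherRoot * otherRoot + C + otherRoot * Q
      ≡⟨ cong (λ c → otherRoot * otherRoot + c + otherRoot * Q) otherRoot-product ⟨
    otherRoot * otherRoot + otherRoot * a + otherRoot * Q
      ≡⟨ factorˡ otherRoot a Q ⟩
    otherRoot * (otherRoot + (a + Q))
      ≡⟨ cong (otherRoot *_) otherRoot-sum ⟩
    otherRoot * R   ∎

m*n>0⇒m>0 : ∀ m {n} → 0 < m * n → 0 < m
m*n>0⇒m>0 (suc _) _ = s≤s z≤n

IsSolution-cong : ∀ {n} (lam : Fin n → ℕ) {x y : Fin n → ℕ} → x ≗ y → IsSolution lam x → IsSolution lam y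
IsSolution-cong {n} lam x≗y = subst₂ _≡_
  (cong₂ _+_ (Σ-cong λ i → cong₂ _*_ (x≗y i) (x≗y i))
             (Σ-cong λ i → cong (lam i *_) (Π-cong (update-cong x≗y i 1))))
  (cong ((n + Σ lam) *_) (Π-cong x≗y))

sqSumExcept-pos : ∀ {n} {x : Fin n → ℕ} → 2 ≤ n → Positive x → ∀ m → 0 < sqSumExcept x m
sqSumExcept-pos {x = x} (s≤s (s≤s _)) pos m = <-≤-trans (*-mono-< (pos j) (pos j))
  (subst (_≤ sqSumExcept x m) (update-other (λ k → x k * x k) 0 (punchInᵢ≢i m zero))
         (f≤Σf (update (λ k → x k * x k) m 0) j))
  where
  j : Fin _
  j = punchIn m zero

prodExcept-update-same : ∀ {n} (x : Fin n → ℕ) m v → prodExcept (update x m v) m ≡ prodExcept x m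
prodExcept-update-same x m v = Π-cong (update-update x m v 1)

prodExcept-update-other : ∀ {n} (x : Fin n → ℕ) {m i} v → i ≢ m →
                          prodExcept (update x m v) i ≡ v * prodExcept (update x m 1) i
prodExcept-update-other x {m} {i} v i≢m = begin
  Π (update (update x m v) i 1)       ≡⟨ Π-cong (update-comm x v 1 (i≢m ∘ sym)) ⟩
  Π (update (update x i 1) m v)       ≡⟨ Π-update (update x i 1) m v ⟩
  v * Π (update (update x i 1) m 1)   ≡⟨ cong (v *_) (Π-cong (update-comm x 1 1 (i≢m ∘ sym))) ⟨
  v * Π (update (update x m 1) i 1)   ∎

module CoordinateQuadratic {n} (lam x : Fin n → ℕ) (m : Fin n) where

  C : ℕ
  C = sqSumExcept x m + lam m * prodExcept x m

  Q : ℕ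
  Q = Σ (update (λ i → lam i * prodExcept (update x m 1) i) m 0)

  R : ℕ
  R = (n + Σ lam) * prodExcept x m

  Σ-squares-update : ∀ v → Σ (λ i → update x m v i * update x m v i) ≡ v * v + sqSumExcept x m
  Σ-squares-update v =
    trans (Σ-cong (update-map (λ t → t * t) x m v)) (Σ-update (λ k → x k * x k) m (v * v))

  Σ-weighted-update : ∀ v →
    Σ (λ i → lam i * prodExcept (update x m v) i) ≡ lam m * prodExcept x m + v * Q
  Σ-weighted-update v = begin
    Σ w
      ≡⟨ Σ-split w m ⟩
    lam m * prodExcept (update x m v) m + Σ (update w m 0)
      ≡⟨ cong₂ _+_ (cong (lam m *_) (prodExcept-update-same x m v)) (Σ-cong update-w) ⟩
    lam m * prodExcept x m + Σ (λ i → v * update c m 0 i)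
      ≡⟨ cong (lam m * prodExcept x m +_) (*-distribˡ-Σ v (update c m 0)) ⟨
    lam m * prodExcept x m + v * Q
      ∎
    where
    w c : Fin n → ℕ
    w i = lam i * prodExcept (update x m v) i
    c i = lam i * prodExcept (update x m 1) i
    update-w : ∀ i → update w m 0 i ≡ v * update c m 0 i
    update-w i with i ≟ m
    ... | yes _   = sym (*-zeroʳ v)
    ... | no i≢m = trans (cong (lam i *_) (prodExcept-update-other x v i≢m)) (x∙yz≈y∙xz (lam i) v _)

  IsSolution-update⇔ : ∀ v → IsSolution lam (update x m v) ⇔ (v * v + C + v * Q ≡ v * R)
  IsSolution-update⇔ v = mk⇔ (subst₂ _≡_ lhs rhs) (subst₂ _≡_ (sym lhs) (sym rhs))
    where
    S = sqSumExcept x m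
    L = lam m * prodExcept x m
    lhs : Σ (λ i → update x m v i * update x m v i) + Σ (λ i → lam i * prodExcept (update x m v) i)
          ≡ v * v + C + v * Q
    lhs = begin
      _                          ≡⟨ cong₂ _+_ (Σ-squares-update v) (Σ-weighted-update v) ⟩
      (v * v + S) + (L + v * Q)  ≡⟨ +-assoc (v * v + S) L (v * Q) ⟨
      v * v + S + L + v * Q      ≡⟨ cong (_+ v * Q) (+-assoc (v * v) S L) ⟩
      v * v + C + v * Q          ∎
    rhs : (n + Σ lam) * Π (update x m v) ≡ v * R
    rhs = trans (cong ((n + Σ lam) *_) (Π-update x m v)) (x∙yz≈y∙xz (n + Σ lam) v (prodExcept x m))

lemma2p1 : (n : ℕ) → 3 ≤ n → (lam : Fin n → ℕ) → (x : Fin n → ℕ) →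
           Positive x → IsSolution lam x → (m : Fin n) →
           Σ[ x′ ∈ ℕ ] ((x′ * x m ≡ sqSumExcept x m + lam m * prodExcept x m)
             × Positive (update x m x′) × IsSolution lam (update x m x′))
lemma2p1 n 3≤n lam x pos sol m =
  otherRoot , otherRoot-product , update-pos pos m otherRoot>0 ,
  Equivalence.from (IsSolution-update⇔ otherRoot) otherRoot-root
  where
  open CoordinateQuadratic lam x m
  x-root : x m * x m + C + x m * Q ≡ x m * R
  x-root = Equivalence.to (IsSolution-update⇔ (x m)) (IsSolution-cong lam (sym ∘ update-id x m) sol)
  open VietaJump (pos m) x-root
  otherRoot>0 : 0 < otherRoot
  otherRoot>0 = m*n>0⇒m>0 otherRoot (subst (0 <_) (sym otherRoot-product)
    (<-≤-trans (sqSumExcept-pos (<⇒≤ 3≤n) pos m) (m≤m+n _ _)))
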